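{- Let $(\alpha_n)_{n\ge0}$ be a sequence of complex numbers and $A_n(x)=\sum_{\nu=0}^{n}\binom{n}{\nu}\alpha_{n-\nu}x^\nu$. For integers $r,s\ge0$ define $A_{r,s}(x)=\sum_{\nu=0}^{r}\binom{r}{\nu}A_{s+\nu}(x)$. If $A_m(1-x)=(-1)^mA_m(x)$ for all $m\ge0$, then for all $r,s\ge0$, $$(-1)^rA_{r,s}(x)=(-1)^sA_{s,r}(-x).$$
   Context: $\alpha_0=0$ is allowed. -}

module Defs where

open import Algebra.Bundles using (CommutativeRing; Semiring)
open import Data.Nat using (ℕ; zero; suc; _∸_) renaming (_+_ to _+ℕ_)
open import Data.Nat.Combinatorics using (_C_)

module Appell {c ℓ} (R : CommutativeRing c ℓ) where
  open CommutativeRing R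
  open import Algebra.Definitions.RawSemiring (Semiring.rawSemiring semiring) using (_×_; _^_)

  sumTo : ℕ → (ℕ → Carrier) → Carrier
  sumTo zero    f = f 0
  sumTo (suc n) f = sumTo n f + f (suc n)

  sign : ℕ → Carrier
  sign n = (- 1#) ^ n

  A : (ℕ → Carrier) → ℕ → Carrier → Carrier
  A α n x = sumTo n (λ ν → (n C ν) × (α (n ∸ ν) * (x ^ ν)))

  Ars : (ℕ → Carrier) → ℕ → ℕ → Carrier → Carrier
  Ars α r s x = sumTo r (λ ν → (r C ν) × A α (s +ℕ ν) x)

{-# OPTIONS --safe #-}
-- For every x, (r, s) ↦ A_{r,s}(x) obeys Pascal's recurrence
-- F (r + 1) s = F r s + F r (s + 1); with the alternating signs this lets an
-- induction on r reduce the identity to r = 0, i.e. to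
-- A_s(x) = (-1)^s A_{s,0}(-x). By the binomial theorem for the Appell
-- sequence, A_{s,0}(y) = Σ_k C(s,k) A_k(y) = A_s(1 + y), so the case r = 0
-- is the hypothesis A_s(1 - x) = (-1)^s A_s(x).
module Submission where

open import Defs
open import Algebra.Bundles using (CommutativeRing; Semiring)
open import Data.Nat using (ℕ; zero; suc; _∸_; _≤_; z≤n) renaming (_+_ to _+ℕ_)
open import Data.Nat.Properties using (+-∸-assoc; ≤-refl; m≤n⇒m≤1+n)
import Data.Nat.Properties as ℕ
open import Data.Nat.Combinatorics using (_C_; k>n⇒nCk≡0; nCk+nC[k+1]≡[n+1]C[k+1])
open import Function using (_∘_)
open import Relation.Binary.PropositionalEquality as ≡ using (cong)
import Algebra.Properties.CommutativeSemigroup as CommutativeSemigroupProperties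

module AppellSymmetry {c ℓ} (R : CommutativeRing c ℓ) where
  open CommutativeRing R
  open Appell R
  open import Algebra.Definitions.RawSemiring (Semiring.rawSemiring semiring) using (_×_; _^_)
  open import Algebra.Properties.Monoid.Mult +-monoid
    using (×-congʳ; ×-congˡ; ×-homo-0; ×-homo-1; ×-homo-+)
  open import Algebra.Properties.CommutativeMonoid.Mult +-commutativeMonoid using (×-distrib-+)
  open import Algebra.Properties.Semiring.Mult semiring using (×-comm-*)
  open import Algebra.Properties.Ring ring using (-1*x≈-x; -‿involutive; -‿distribʳ-*)
  open import Algebra.Properties.AbelianGroup +-abelianGroup using (⁻¹-anti-homo‿-; xyx⁻¹≈y)
  module +-Comm = CommutativeSemigroupProperties +-commutativeSemigroup
  module *-Comm = CommutativeSemigroupProperties *-commutativeSemigroup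
  open import Relation.Binary.Reasoning.Setoid setoid

  sumTo-cong≤ : ∀ n {f g : ℕ → Carrier} → (∀ ν → ν ≤ n → f ν ≈ g ν) → sumTo n f ≈ sumTo n g
  sumTo-cong≤ zero    f≈g = f≈g 0 z≤n
  sumTo-cong≤ (suc n) f≈g =
    +-cong (sumTo-cong≤ n (λ ν ν≤n → f≈g ν (m≤n⇒m≤1+n ν≤n))) (f≈g (suc n) ≤-refl)

  sumTo-distrib-+ : ∀ n (f g : ℕ → Carrier) → sumTo n (λ ν → f ν + g ν) ≈ sumTo n f + sumTo n g
  sumTo-distrib-+ zero    f g = refl
  sumTo-distrib-+ (suc n) f g =
    trans (+-congʳ (sumTo-distrib-+ n f g)) (+-Comm.interchange _ _ _ _)

  *-distribˡ-sumTo : ∀ n x (f : ℕ → Carrier) → x * sumTo n f ≈ sumTo n (λ ν → x * f ν)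
  *-distribˡ-sumTo zero    x f = refl
  *-distribˡ-sumTo (suc n) x f = trans (distribˡ x _ _) (+-congʳ (*-distribˡ-sumTo n x f))

  sumTo-suc-head : ∀ n (f : ℕ → Carrier) → sumTo (suc n) f ≈ f 0 + sumTo n (f ∘ suc)
  sumTo-suc-head zero    f = refl
  sumTo-suc-head (suc n) f = trans (+-congʳ (sumTo-suc-head n f)) (+-assoc _ _ _)

  sumTo-suc-last-0 : ∀ n {f : ℕ → Carrier} → f (suc n) ≈ 0# → sumTo (suc n) f ≈ sumTo n f
  sumTo-suc-last-0 n f[1+n]≈0 = trans (+-congˡ f[1+n]≈0) (+-identityʳ _)

  binomialSum : ℕ → (ℕ → Carrier) → Carrier
  binomialSum n f = sumTo n (λ ν → (n C ν) × f ν)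

  binomialSum-cong≤ : ∀ n {f g : ℕ → Carrier} → (∀ ν → ν ≤ n → f ν ≈ g ν) →
                      binomialSum n f ≈ binomialSum n g
  binomialSum-cong≤ n f≈g = sumTo-cong≤ n (λ ν ν≤n → ×-congʳ (n C ν) (f≈g ν ν≤n))

  binomialSum-cong : ∀ n {f g : ℕ → Carrier} → (∀ ν → f ν ≈ g ν) → binomialSum n f ≈ binomialSum n g
  binomialSum-cong n f≈g = binomialSum-cong≤ n (λ ν _ → f≈g ν)

  binomialSum-zero : ∀ (f : ℕ → Carrier) → binomialSum 0 f ≈ f 0
  binomialSum-zero f = ×-homo-1 (f 0)

  binomialSum-distrib-+ : ∀ n (f g : ℕ → Carrier) →
                          binomialSum n (λ ν → f ν + g ν) ≈ binomialSum n f + binomialSum n g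
  binomialSum-distrib-+ n f g =
    trans (sumTo-cong≤ n (λ ν _ → ×-distrib-+ (f ν) (g ν) (n C ν))) (sumTo-distrib-+ n _ _)

  *-distribˡ-binomialSum : ∀ n x (f : ℕ → Carrier) →
                           x * binomialSum n f ≈ binomialSum n (λ ν → x * f ν)
  *-distribˡ-binomialSum n x f =
    trans (*-distribˡ-sumTo n x _) (sumTo-cong≤ n (λ ν _ → ×-comm-* (n C ν) x (f ν)))

  binomialSum-suc : ∀ n (f : ℕ → Carrier) →
                    binomialSum (suc n) f ≈ binomialSum n f + binomialSum n (f ∘ suc)
  binomialSum-suc n f = begin
    binomialSum (suc n) f
      ≈⟨ sumTo-suc-head n _ ⟩
    first + sumTo n (λ ν → (suc n C suc ν) × f (suc ν))
      ≈⟨ +-congˡ (trans (sumTo-cong≤ n pascal) (sumTo-distrib-+ n _ _)) ⟩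
    first + (binomialSum n (f ∘ suc) + rest)
      ≈⟨ +-Comm.x∙yz≈xz∙y first _ rest ⟩
    (first + rest) + binomialSum n (f ∘ suc)
      ≈⟨ +-congʳ (sym binomialSum-split) ⟩
    binomialSum n f + binomialSum n (f ∘ suc)
      ∎
    where
    first rest : Carrier
    first = (suc n C 0) × f 0
    rest  = sumTo n (λ ν → (n C suc ν) × f (suc ν))

    pascal : ∀ ν → ν ≤ n →
             (suc n C suc ν) × f (suc ν) ≈ (n C ν) × f (suc ν) + (n C suc ν) × f (suc ν)
    pascal ν _ =
      trans (×-congˡ (≡.sym (nCk+nC[k+1]≡[n+1]C[k+1] n ν))) (×-homo-+ _ (n C ν) (n C suc ν))

    binomialSum-split : binomialSum n f ≈ first + rest
    binomialSum-split = begin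
      binomialSum n f
        ≈⟨ sym (sumTo-suc-last-0 n last-vanishes) ⟩
      sumTo (suc n) (λ ν → (n C ν) × f ν)
        ≈⟨ sumTo-suc-head n _ ⟩
      first + rest
        ∎
      where
      last-vanishes : (n C suc n) × f (suc n) ≈ 0#
      last-vanishes = trans (×-congˡ (k>n⇒nCk≡0 {n} ≤-refl)) (×-homo-0 (f (suc n)))

  A-suc : ∀ (α : ℕ → Carrier) n x → A α (suc n) x ≈ A (α ∘ suc) n x + x * A α n x
  A-suc α n x = begin
    A α (suc n) x
      ≈⟨ binomialSum-suc n (λ ν → α (suc n ∸ ν) * x ^ ν) ⟩
    binomialSum n (λ ν → α (suc n ∸ ν) * x ^ ν) + binomialSum n (λ ν → α (n ∸ ν) * (x * x ^ ν))
      ≈⟨ +-cong (binomialSum-cong≤ n (λ ν ν≤n → *-congʳ (reflexive (cong α (+-∸-assoc 1 ν≤n)))))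
                (binomialSum-cong n (λ ν → *-Comm.x∙yz≈y∙xz (α (n ∸ ν)) x (x ^ ν))) ⟩
    A (α ∘ suc) n x + binomialSum n (λ ν → x * (α (n ∸ ν) * x ^ ν))
      ≈⟨ +-congˡ (sym (*-distribˡ-binomialSum n x _)) ⟩
    A (α ∘ suc) n x + x * A α n x
      ∎

  binomialSum-A : ∀ (α : ℕ → Carrier) s y → binomialSum s (λ k → A α k y) ≈ A α s (1# + y)
  binomialSum-A α zero    y = binomialSum-zero (λ k → A α k y)
  binomialSum-A α (suc s) y = begin
    binomialSum (suc s) (λ k → A α k y)
      ≈⟨ binomialSum-suc s _ ⟩
    Σα + binomialSum s (λ k → A α (suc k) y)
      ≈⟨ +-congˡ (binomialSum-cong s (λ k → A-suc α k y)) ⟩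
    Σα + binomialSum s (λ k → A (α ∘ suc) k y + y * A α k y)
      ≈⟨ +-congˡ (trans (binomialSum-distrib-+ s _ _) (+-congˡ (sym (*-distribˡ-binomialSum s y _)))) ⟩
    Σα + (binomialSum s (λ k → A (α ∘ suc) k y) + y * Σα)
      ≈⟨ +-cong ih (+-cong (binomialSum-A (α ∘ suc) s y) (*-congˡ ih)) ⟩
    Aα + (Aσα + y * Aα)
      ≈⟨ +-Comm.x∙yz≈y∙xz Aα Aσα (y * Aα) ⟩
    Aσα + (Aα + y * Aα)
      ≈⟨ +-congˡ (trans (+-congʳ (sym (*-identityˡ Aα))) (sym (distribʳ Aα 1# y))) ⟩
    Aσα + (1# + y) * Aα
      ≈⟨ sym (A-suc α s (1# + y)) ⟩
    A α (suc s) (1# + y)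
      ∎
    where
    Σα Aα Aσα : Carrier
    Σα  = binomialSum s (λ k → A α k y)
    Aα  = A α s (1# + y)
    Aσα = A (α ∘ suc) s (1# + y)

    ih : Σα ≈ Aα
    ih = binomialSum-A α s y

  Ars-zero : ∀ (α : ℕ → Carrier) s x → Ars α 0 s x ≈ A α s x
  Ars-zero α s x = trans (binomialSum-zero (λ ν → A α (s +ℕ ν) x))
                         (reflexive (cong (λ k → A α k x) (ℕ.+-identityʳ s)))

  Ars-suc : ∀ (α : ℕ → Carrier) r s x → Ars α (suc r) s x ≈ Ars α r s x + Ars α r (suc s) x
  Ars-suc α r s x = trans (binomialSum-suc r _)
    (+-congˡ (binomialSum-cong r (λ ν → reflexive (cong (λ k → A α k x) (ℕ.+-suc s ν)))))

  sign-suc : ∀ n y → sign (suc n) * y ≈ - (sign n * y)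
  sign-suc n y = trans (*-assoc (- 1#) (sign n) y) (-1*x≈-x _)

  sign-cancelˡ : ∀ n y → sign n * (sign n * y) ≈ y
  sign-cancelˡ zero    y = trans (*-identityˡ _) (*-identityˡ y)
  sign-cancelˡ (suc n) y = begin
    sign (suc n) * (sign (suc n) * y) ≈⟨ sign-suc n _ ⟩
    - (sign n * (sign (suc n) * y))   ≈⟨ -‿cong (*-congˡ (sign-suc n y)) ⟩
    - (sign n * - (sign n * y))       ≈⟨ -‿cong (sym (-‿distribʳ-* _ _)) ⟩
    - - (sign n * (sign n * y))       ≈⟨ -‿involutive _ ⟩
    sign n * (sign n * y)             ≈⟨ sign-cancelˡ n y ⟩
    y                                 ∎

  PascalRecurrent : (ℕ → ℕ → Carrier) → Set ℓ
  PascalRecurrent F = ∀ r s → F (suc r) s ≈ F r s + F r (suc s)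

  signed-transpose : ∀ {F G : ℕ → ℕ → Carrier} → PascalRecurrent F → PascalRecurrent G →
                     (∀ s → F 0 s ≈ sign s * G s 0) →
                     ∀ r s → sign r * F r s ≈ sign s * G s r
  signed-transpose F-suc G-suc base zero    s = trans (*-identityˡ _) (base s)
  signed-transpose {F} {G} F-suc G-suc base (suc r) s = begin
    sign (suc r) * F (suc r) s
      ≈⟨ sign-suc r _ ⟩
    - (sign r * F (suc r) s)
      ≈⟨ -‿cong (trans (*-congˡ (F-suc r s)) (distribˡ _ _ _)) ⟩
    - (sign r * F r s + sign r * F r (suc s))
      ≈⟨ -‿cong (+-cong (ih s) (ih (suc s))) ⟩
    - (p + sign (suc s) * G (suc s) r)
      ≈⟨ -‿cong (+-congˡ (sign-suc s _)) ⟩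
    - (p + - (sign s * G (suc s) r))
      ≈⟨ -‿cong (+-congˡ (-‿cong (trans (*-congˡ (G-suc s r)) (distribˡ _ _ _)))) ⟩
    - (p + - (p + q))
      ≈⟨ ⁻¹-anti-homo‿- p (p + q) ⟩
    (p + q) - p
      ≈⟨ xyx⁻¹≈y p q ⟩
    q
      ∎
    where
    ih : ∀ s → sign r * F r s ≈ sign s * G s r
    ih = signed-transpose F-suc G-suc base r
    p q : Carrier
    p = sign s * G s r
    q = sign s * G s (suc r)

theorem3p1 : ∀ {c ℓ} (R : CommutativeRing c ℓ) →
      let open CommutativeRing R
          open Appell R
      in (α : ℕ → Carrier) →
         (∀ (m : ℕ) (x : Carrier) → A α m (1# - x) ≈ sign m * A α m x) →
         ∀ (r s : ℕ) (x : Carrier) → sign r * Ars α r s x ≈ sign s * Ars α s r (- x)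
theorem3p1 R α symmetric r s x =
  signed-transpose (λ r s → Ars-suc α r s x) (λ s r → Ars-suc α s r (- x)) base r s
  where
  open CommutativeRing R
  open Appell R
  open AppellSymmetry R
  open import Relation.Binary.Reasoning.Setoid setoid

  base : ∀ s → Ars α 0 s x ≈ sign s * Ars α s 0 (- x)
  base s = begin
    Ars α 0 s x                  ≈⟨ Ars-zero α s x ⟩
    A α s x                      ≈⟨ sym (sign-cancelˡ s _) ⟩
    sign s * (sign s * A α s x)  ≈⟨ *-congˡ (sym (symmetric s x)) ⟩
    sign s * A α s (1# - x)      ≈⟨ *-congˡ (sym (binomialSum-A α s (- x))) ⟩
    sign s * Ars α s 0 (- x)     ∎
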